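{- The only prime $p$ that is Brazilian and such that $(p-1)/2$ is also prime (i.e., $p$ is a safe prime) is $p=7$.
   Context: A positive integer $n$ is Brazilian if there is an integer $b$ with $1<b<n-1$ such that all digits of the base-$b$ representation of $n$ are equal; equivalently $n = m\frac{b^q-1}{b-1}$ for some integers $1\le m<b$, $q\ge 2$ and $1<b<n-1$. A prime $p$ is a safe prime if $(p-1)/2$ is prime. -}

module Defs where

open import Data.Nat using (ℕ; zero; suc; _+_; _*_; _∸_; _^_; _≤_; _<_)
open import Data.Nat.Primality using (Prime)
open import Data.Product using (Σ; ∃; _×_)
open import Relation.Binary.PropositionalEquality using (_≡_)

-- repunit b q = 1 + b + ... + b^(q-1) = (b^q - 1)/(b - 1)
repunit : ℕ → ℕ → ℕ
repunit b zero    = 0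
repunit b (suc q) = 1 + b * repunit b q

Brazilian : ℕ → Set
Brazilian n = ∃ λ b → ∃ λ m → ∃ λ q →
  (1 < b) × (b < n ∸ 1) × (1 ≤ m) × (m < b) × (2 ≤ q) × (n ≡ m * repunit b q)

SafePrime : ℕ → Set
SafePrime p = Prime p × (∃ λ r → (p ∸ 1 ≡ 2 * r) × Prime r)

-- In a Brazilian prime p = m (b^q - 1)/(b - 1) the digit m is a proper divisor, so
-- m = 1; the bound b < p - 1 rules out q = 2, so p - 1 = b (b^(q-1) - 1)/(b - 1) with a second
-- factor at least 3. If p - 1 = 2r with r prime, comparing the two factorisations forces b = 2,
-- i.e. r = 2^(q-1) - 1 and p = 2^q - 1. One of any two consecutive numbers 2^n - 1 is divisible
-- by 3, so one of r, p equals 3, and this leaves only r = 3, p = 7.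
module Submission where

open import Defs
open import Data.Nat using (ℕ; zero; suc; _+_; _*_; _∸_; _≤_; _<_; s≤s; z≤n)
open import Data.Nat.Properties
open import Data.Nat.Divisibility
  using (_∣_; divides; ∣⇒≤; n∣m*n; ∣n⇒∣m*n; ∣m∣n⇒∣m+n; *-monoʳ-∣; *-cancelʳ-∣)
open import Data.Nat.Primality using (Prime; prime⇒irreducible; prime⇒nonZero; euclidsLemma; ¬prime[1]; prime?)
open import Data.Nat.Tactic.RingSolver using (solve-∀)
open import Data.Product using (_×_; _,_; ∃₂)
open import Data.Sum using (_⊎_; inj₁; inj₂)
open import Data.Empty using (⊥-elim)
open import Function.Bundles using (_⇔_; mk⇔)
open import Relation.Binary.PropositionalEquality using (_≡_; refl; sym; trans; cong; subst)
open import Relation.Nullary.Decidable using (from-yes)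

1+b≤repunit : ∀ b q → 1 + b ≤ repunit b (2 + q)
1+b≤repunit b q = s≤s (m≤m*n b (repunit b (1 + q)))

repunit-1 : ∀ b → repunit b 1 ≡ 1
repunit-1 b = cong suc (*-zeroʳ b)

prime-proper-divisor⇒≡1 : ∀ {p d} → Prime p → d ∣ p → d < p → d ≡ 1
prime-proper-divisor⇒≡1 pP d∣p d<p with prime⇒irreducible pP d∣p
... | inj₁ d≡1 = d≡1
... | inj₂ refl = ⊥-elim (<-irrefl refl d<p)

prime-brazilian⇒repunit : ∀ {p} → Prime p → Brazilian p → ∃₂ λ b q → 1 < b × p ≡ repunit b (3 + q)
prime-brazilian⇒repunit {p} pP (b , m , q , 1<b , b<p∸1 , _ , m<b , 2≤q , p≡mR)
  with prime-proper-divisor⇒≡1 pP (divides (repunit b q) (trans p≡mR (*-comm m _))) m<p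
  where
  m<p : m < p
  m<p = <-≤-trans m<b (≤-trans (<⇒≤ b<p∸1) (m∸n≤m p 1))
... | refl = atLeastThreeDigits q 2≤q (trans p≡mR (*-identityˡ _))
  where
  atLeastThreeDigits : ∀ q → 2 ≤ q → p ≡ repunit b q → ∃₂ λ b' q' → 1 < b' × p ≡ repunit b' (3 + q')
  atLeastThreeDigits (suc zero) (s≤s ()) _
  atLeastThreeDigits (suc (suc zero)) _ p≡R = ⊥-elim (<-irrefl (sym p∸1≡b) b<p∸1)
    where
    p∸1≡b : p ∸ 1 ≡ b
    p∸1≡b = trans (cong (_∸ 1) p≡R) (trans (cong (b *_) (repunit-1 b)) (*-identityʳ b))
  atLeastThreeDigits (suc (suc (suc q'))) _ p≡R = b , q' , 1<b , p≡R

double-prime≡product : ∀ {r b R} → Prime r → 2 ≤ b → 3 ≤ R → 2 * r ≡ b * R → b ≡ 2 × R ≡ r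
double-prime≡product {r} {b} {R} rP 2≤b 3≤R 2r≡bR
  with euclidsLemma b R rP (subst (r ∣_) 2r≡bR (n∣m*n 2))
... | inj₁ r∣b = ⊥-elim (<⇒≱ 3≤R (∣⇒≤ R∣2))
  where
  instance _ = prime⇒nonZero rP
  R∣2 : R ∣ 2
  R∣2 = *-cancelʳ-∣ r (subst (R * r ∣_) (trans (*-comm R b) (sym 2r≡bR)) (*-monoʳ-∣ R r∣b))
... | inj₂ r∣R = b≡2 , *-cancelˡ-≡ R r 2 (sym (subst (λ c → 2 * r ≡ c * R) b≡2 2r≡bR))
  where
  instance _ = prime⇒nonZero rP
  b∣2 : b ∣ 2
  b∣2 = *-cancelʳ-∣ r (subst (b * r ∣_) (sym 2r≡bR) (*-monoʳ-∣ b r∣R))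
  b≡2 : b ≡ 2
  b≡2 = ≤-antisym (∣⇒≤ b∣2) 2≤b

repunit2-step : ∀ n → repunit 2 (2 + n) ≡ 3 + 4 * repunit 2 n
repunit2-step n = expand (repunit 2 n)
  where
  expand : ∀ x → 1 + 2 * (1 + 2 * x) ≡ 3 + 4 * x
  expand = solve-∀

3∣repunit2⊎3∣repunit2-suc : ∀ n → 3 ∣ repunit 2 n ⊎ 3 ∣ repunit 2 (suc n)
3∣repunit2⊎3∣repunit2-suc zero = inj₁ (divides 0 refl)
3∣repunit2⊎3∣repunit2-suc (suc n) with 3∣repunit2⊎3∣repunit2-suc n
... | inj₂ 3∣R = inj₁ 3∣R
... | inj₁ 3∣R = inj₂ (subst (3 ∣_) (sym (repunit2-step n)) (∣m∣n⇒∣m+n (divides 1 refl) (∣n⇒∣m*n 4 3∣R)))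

repunit2≡3⇒≡2 : ∀ n → repunit 2 n ≡ 3 → n ≡ 2
repunit2≡3⇒≡2 (suc (suc zero)) _ = refl
repunit2≡3⇒≡2 (suc (suc (suc n))) eq with trans (sym (repunit2-step (suc n))) eq
... | ()

prime-3∣⇒≡3 : ∀ {p} → Prime p → 3 ∣ p → p ≡ 3
prime-3∣⇒≡3 pP 3∣p with prime⇒irreducible pP 3∣p
... | inj₂ 3≡p = sym 3≡p

consecutive-repunit2-primes⇒≡2 : ∀ n → Prime (repunit 2 n) → Prime (repunit 2 (suc n)) → n ≡ 2
consecutive-repunit2-primes⇒≡2 n P P′ with 3∣repunit2⊎3∣repunit2-suc n
... | inj₁ 3∣R = repunit2≡3⇒≡2 n (prime-3∣⇒≡3 P 3∣R)
... | inj₂ 3∣R′ with repunit2≡3⇒≡2 (suc n) (prime-3∣⇒≡3 P′ 3∣R′)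
... | refl = ⊥-elim (¬prime[1] P)

safePrime∧brazilian⇒≡7 : ∀ {p} → SafePrime p → Brazilian p → p ≡ 7
safePrime∧brazilian⇒≡7 {p} (pP , r , p∸1≡2r , rP) brazilian
  with prime-brazilian⇒repunit pP brazilian
... | b , q , 1<b , p≡R
  with double-prime≡product rP 1<b (≤-trans (s≤s 1<b) (1+b≤repunit b q)) (trans (sym p∸1≡2r) (cong (_∸ 1) p≡R))
... | refl , R≡r
  with consecutive-repunit2-primes⇒≡2 (2 + q) (subst Prime (sym R≡r) rP) (subst Prime p≡R pP)
... | refl = p≡R

proposition5 : (p : ℕ) → (SafePrime p × Brazilian p) ⇔ (p ≡ 7)
proposition5 p = mk⇔ (λ (safe , brazilian) → safePrime∧brazilian⇒≡7 safe brazilian) 7-safe∧brazilian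
  where
  7-safe∧brazilian : p ≡ 7 → SafePrime p × Brazilian p
  7-safe∧brazilian refl =
    (from-yes (prime? 7) , 3 , refl , from-yes (prime? 3)) ,
    2 , 1 , 3 , s≤s (s≤s z≤n) , s≤s (s≤s (s≤s z≤n)) , s≤s z≤n , s≤s (s≤s z≤n) , s≤s (s≤s z≤n) , refl
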